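{- Let $s=(s_1,\dots,s_n)$ be a weak composition (nonnegative integers). Then \[\prod_{i=1}^{n-1}\Big(1+\sum_{r=n-i+1}^ns_r\Big)=\sum_{\mathbf j}\binom{s_n+1}{j_1}\binom{s_{n-1}+1}{j_2}\cdots\binom{s_2+1}{j_{n-1}}\prod_{i=1}^{n-1}(j_1+\cdots+j_i-i+1)\] \[=\sum_{\mathbf j}\binom{s_n+j_1}{j_1}\binom{s_{n-1}+j_2-2}{j_2}\cdots\binom{s_2+j_{n-1}-2}{j_{n-1}}\prod_{i=1}^{n-1}(j_1+\cdots+j_i-i+1),\] where both sums run over weak compositions $\mathbf j=(j_1,\dots,j_{n-1})$ of $n-1$ (nonnegative integers summing to $n-1$) satisfying $j_1+\cdots+j_k\ge k$ for all $k\in[n-1]$.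
   Context: Binomial coefficients $\binom{x}{k}=x(x-1)\cdots(x-k+1)/k!$ are taken as polynomials in the upper argument, so they are defined for negative integer $x$. The second sum is the paper's formula $\sum_{\mathbf j}\left(\!\binom{s_n+1}{j_1}\!\right)\left(\!\binom{s_{n-1}-1}{j_2}\!\right)\cdots\left(\!\binom{s_2-1}{j_{n-1}}\!\right)\prod_i(\cdots)$ with the multiset coefficient $\left(\!\binom{m}{k}\!\right)=\binom{m+k-1}{k}$ written out. The left-hand side equals the number of $s$-decreasing trees (elements of the $s$-weak order). -}

module Defs where

open import Data.Nat as ℕ using (ℕ; zero; suc; _∸_; _!; _≤?_)
open import Data.Nat.Properties using (_!≢0)
open import Data.Integer as ℤ using (ℤ; +_; _/ℕ_)
open import Data.List as List using (List; []; _∷_; map; upTo; filter; foldr; take; concatMap)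
open import Data.Vec as Vec using (Vec; toList)
open import Data.Bool using (Bool; _∧_)
open import Relation.Nullary.Decidable using (⌊_⌋)
open import Data.List.Relation.Unary.All using (All; all?)
open import Data.Nat.ListAction using () renaming (sum to sumℕ)
open import Relation.Binary.PropositionalEquality using (_≡_)
open import Data.Product using (_×_)
open import Relation.Nullary using (Dec)
open import Relation.Nullary.Decidable using (_×-dec_)

sumℤ : List ℤ → ℤ
sumℤ = foldr ℤ._+_ (+ 0)

prodℤ : List ℤ → ℤ
prodℤ = foldr ℤ._*_ (+ 1)

-- the integer interval [a, b] = a, a+1, …, b  (empty if b < a)
range : ℕ → ℕ → List ℕ
range a b = map (a ℕ.+_) (upTo (suc b ∸ a))

Σ[_⋯_] : ℕ → ℕ → (ℕ → ℤ) → ℤ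
Σ[ a ⋯ b ] f = sumℤ (map f (range a b))

Π[_⋯_] : ℕ → ℕ → (ℕ → ℤ) → ℤ
Π[ a ⋯ b ] f = prodℤ (map f (range a b))

falling : ℤ → ℕ → ℤ
falling x k = prodℤ (map (λ t → x ℤ.- + t) (upTo k))

-- binomial coefficient as a polynomial in the upper argument:
-- binom x k = x (x-1) ⋯ (x-k+1) / k!   (the division is exact)
binom : ℤ → ℕ → ℤ
binom x k = (falling x k /ℕ (k !)) {{k !≢0}}

-- 1-based access into a list (default 0 outside the range; never used there)
at : List ℕ → ℕ → ℕ
at []       _             = 0
at (x ∷ xs) zero          = 0
at (x ∷ xs) (suc zero)    = x
at (x ∷ xs) (suc (suc r)) = at xs (suc r)

_⟨_⟩ : ∀ {n} → Vec ℕ n → ℕ → ℕ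
s ⟨ r ⟩ = at (toList s) r

psum : ∀ {m} → Vec ℕ m → ℕ → ℕ
psum j i = sumℕ (take i (toList j))

box : ℕ → (k : ℕ) → List (Vec ℕ k)
box b zero    = Vec.[] ∷ []
box b (suc k) = concatMap (λ x → map (x Vec.∷_) (box b k)) (upTo (suc b))

ValidComp : (m : ℕ) → Vec ℕ m → Set
ValidComp m j = (sumℕ (toList j) ≡ m) × All (λ k → k ℕ.≤ psum j k) (range 1 m)

validComp? : (m : ℕ) → (j : Vec ℕ m) → Dec (ValidComp m j)
validComp? m j = (sumℕ (toList j) ℕ.≟ m) ×-dec all? (λ k → k ≤? psum j k) (range 1 m)

-- Σ over all weak compositions j = (j_1, …, j_m) of m with j_1 + ⋯ + j_k ≥ k (k ∈ [m]).
-- (Every such j has entries ≤ m, so it occurs exactly once in  box m m.)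
Σcomp : (m : ℕ) → (Vec ℕ m → ℤ) → ℤ
Σcomp m f = sumℤ (map f (filter (validComp? m) (box m m)))

weight : (m : ℕ) → Vec ℕ m → ℤ
weight m j = Π[ 1 ⋯ m ] (λ i → (+ psum j i ℤ.- + i) ℤ.+ + 1)

-- the i-th binomial factor of the second sum (x = s_{n+1-i}, y = j_i):
--   i = 1 : binom (s_n + j_1) j_1 ;   i ≥ 2 : binom (s_{n+1-i} + j_i - 2) j_i
factor₂ : (i x y : ℕ) → ℤ
factor₂ (suc zero) x y = binom (+ x ℤ.+ + y) y
factor₂ _          x y = binom ((+ x ℤ.+ + y) ℤ.- + 2) y

module Submission where

-- Write P(x, m) for Σ_j Π_i binom(x_i, j_i) · Π_i (j₁ + ⋯ + j_i − i + 1), summed over the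
-- compositions j of m counted by Σcomp. Then P(x, m) = Π_{t<m} (x₁ + ⋯ + x_{t+1} − t) for all
-- integers x_i. A vector of total m violating the prefix condition has a vanishing weight, so the
-- sum may run over all vectors of total m. For an arbitrary total N, splitting off the last entry
-- and applying Vandermonde's convolution and absorption gives, by induction on the length k,
--   Π_{t<k} (x₁ + ⋯ + x_{t+1} − t) · binom(x₁ + ⋯ + x_k − k, N − k).
-- The first equality is the case x_i = s_{n+1−i} + 1. For the second, upper negation turns each
-- binomial factor into (−1)^{j_i} binom(x′_i, j_i) with x′₁ = −s_n − 1 and x′_i = 1 − s_{n+1−i},
-- and the product formula for x′ is (−1)^{n−1} times the one for x.

open import Defs
open import Data.Nat as ℕ using (ℕ; zero; suc; _∸_; _≤_; _<_; z≤n; s≤s; _!)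
import Data.Nat.Properties as ℕP
import Data.Nat.DivMod as ℕD
open import Data.Nat.ListAction using () renaming (sum to sumℕ)
open import Data.Integer as ℤ using (ℤ; +_; -[1+_]; _+_; _*_; _-_; -_; _^_; -1ℤ; _/ℕ_)
import Data.Integer.Properties as ℤP
open import Data.Integer.Tactic.RingSolver using (solve-∀)
open import Data.List as List using (List; []; _∷_; map; upTo; filter; concatMap; _++_)
import Data.List.Properties as LP
open import Data.List.Relation.Unary.All as All using (All; []; _∷_)
import Data.List.Relation.Unary.All.Properties as AllP
open import Data.Vec as Vec using (Vec; toList; _∷ʳ_)
open import Data.Product using (_×_; _,_; ∃; proj₁)
open import Data.Sum using (_⊎_; inj₁; inj₂)
open import Relation.Nullary using (Dec; yes; no; ¬_)
open import Relation.Unary using (Decidable)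
open import Relation.Binary.PropositionalEquality
open import Function using (_∘_)
open import Data.Empty using (⊥-elim)

open ≡-Reasoning

-- Integer sums and products

𝟙 : ∀ {P : Set} → Dec P → ℤ
𝟙 (yes _) = + 1
𝟙 (no _)  = + 0

𝟙-≟-subst : ∀ {a b} (f : ℤ → ℤ) → 𝟙 (a ℤ.≟ b) * f a ≡ 𝟙 (a ℤ.≟ b) * f b
𝟙-≟-subst {a} {b} f with a ℤ.≟ b
... | yes refl = refl
... | no _     = refl

𝟙-≟-shift : ∀ a c b → 𝟙 (a + c ℤ.≟ b) ≡ 𝟙 (a ℤ.≟ b - c)
𝟙-≟-shift a c b with a + c ℤ.≟ b | a ℤ.≟ b - c
... | yes _   | yes _   = refl
... | no _    | no _    = refl
... | yes a+c≡b | no a≢b-c = ⊥-elim (a≢b-c (trans (addSub a c) (cong (_- c) a+c≡b)))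
  where
  addSub : ∀ a c → a ≡ a + c - c
  addSub = solve-∀
... | no a+c≢b | yes a≡b-c = ⊥-elim (a+c≢b (trans (cong (_+ c) a≡b-c) (subAdd b c)))
  where
  subAdd : ∀ b c → b - c + c ≡ b
  subAdd = solve-∀

sumℤ-++ : ∀ xs ys → sumℤ (xs ++ ys) ≡ sumℤ xs + sumℤ ys
sumℤ-++ []       ys = sym (ℤP.+-identityˡ _)
sumℤ-++ (x ∷ xs) ys = trans (cong (_+_ x) (sumℤ-++ xs ys)) (sym (ℤP.+-assoc x _ _))

prodℤ-++ : ∀ xs ys → prodℤ (xs ++ ys) ≡ prodℤ xs * prodℤ ys
prodℤ-++ []       ys = sym (ℤP.*-identityˡ _)
prodℤ-++ (x ∷ xs) ys = trans (cong (x *_) (prodℤ-++ xs ys)) (sym (ℤP.*-assoc x _ _))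

module _ {A : Set} where

  sum-map-+ : ∀ (xs : List A) f g →
              sumℤ (map (λ a → f a + g a) xs) ≡ sumℤ (map f xs) + sumℤ (map g xs)
  sum-map-+ []       f g = refl
  sum-map-+ (x ∷ xs) f g =
    trans (cong (_+_ (f x + g x)) (sum-map-+ xs f g)) (interchange (f x) (g x) _ _)
    where
    interchange : ∀ a b c d → a + b + (c + d) ≡ a + c + (b + d)
    interchange = solve-∀

  sum-map-*ˡ : ∀ c (xs : List A) f → sumℤ (map (λ a → c * f a) xs) ≡ c * sumℤ (map f xs)
  sum-map-*ˡ c []       f = sym (ℤP.*-zeroʳ c)
  sum-map-*ˡ c (x ∷ xs) f =
    trans (cong (_+_ (c * f x)) (sum-map-*ˡ c xs f)) (sym (ℤP.*-distribˡ-+ c (f x) _))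

  sum-map-0 : ∀ (xs : List A) f → (∀ a → f a ≡ + 0) → sumℤ (map f xs) ≡ + 0
  sum-map-0 []       f f≡0 = refl
  sum-map-0 (x ∷ xs) f f≡0 = cong₂ _+_ (f≡0 x) (sum-map-0 xs f f≡0)

  prod-map-* : ∀ (xs : List A) f g →
               prodℤ (map (λ a → f a * g a) xs) ≡ prodℤ (map f xs) * prodℤ (map g xs)
  prod-map-* []       f g = refl
  prod-map-* (x ∷ xs) f g =
    trans (cong (f x * g x *_) (prod-map-* xs f g)) (interchange (f x) (g x) _ _)
    where
    interchange : ∀ a b c d → a * b * (c * d) ≡ a * c * (b * d)
    interchange = solve-∀

  sum-filter : ∀ {P : A → Set} (P? : Decidable P) xs f →
               sumℤ (map f (filter P? xs)) ≡ sumℤ (map (λ a → 𝟙 (P? a) * f a) xs)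
  sum-filter P? []       f = refl
  sum-filter P? (x ∷ xs) f with P? x
  ... | yes _ = cong₂ _+_ (sym (ℤP.*-identityˡ (f x))) (sum-filter P? xs f)
  ... | no _  = trans (sum-filter P? xs f) (sym (ℤP.+-identityˡ _))

module _ {A B : Set} where

  sum-concatMap : ∀ (xs : List A) (h : A → List B) g →
                  sumℤ (map g (concatMap h xs)) ≡ sumℤ (map (λ a → sumℤ (map g (h a))) xs)
  sum-concatMap []       h g = refl
  sum-concatMap (x ∷ xs) h g = begin
    sumℤ (map g (h x ++ concatMap h xs))
      ≡⟨ cong sumℤ (LP.map-++ g (h x) _) ⟩
    sumℤ (map g (h x) ++ map g (concatMap h xs))
      ≡⟨ sumℤ-++ (map g (h x)) _ ⟩
    sumℤ (map g (h x)) + sumℤ (map g (concatMap h xs))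
      ≡⟨ cong (_+_ (sumℤ (map g (h x)))) (sum-concatMap xs h g) ⟩
    sumℤ (map (λ a → sumℤ (map g (h a))) (x ∷ xs)) ∎

  sum-swap : ∀ (xs : List A) (ys : List B) (f : A → B → ℤ) →
             sumℤ (map (λ a → sumℤ (map (f a) ys)) xs) ≡
             sumℤ (map (λ b → sumℤ (map (λ a → f a b) xs)) ys)
  sum-swap []       ys f = sym (sum-map-0 ys _ (λ _ → refl))
  sum-swap (x ∷ xs) ys f =
    trans (cong (_+_ (sumℤ (map (f x) ys))) (sum-swap xs ys f)) (sym (sum-map-+ ys (f x) _))

∑< : ℕ → (ℕ → ℤ) → ℤ
∑< n f = sumℤ (map f (upTo n))

∏< : ℕ → (ℕ → ℤ) → ℤ
∏< n f = prodℤ (map f (upTo n))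

upTo-suc : ∀ n → upTo (suc n) ≡ 0 ∷ map suc (upTo n)
upTo-suc n = cong (0 ∷_) (sym (LP.map-upTo suc n))

∑<-suc : ∀ n f → ∑< (suc n) f ≡ ∑< n f + f n
∑<-suc n f = begin
  sumℤ (map f (upTo (suc n)))             ≡⟨ cong (sumℤ ∘ map f) (sym (LP.upTo-∷ʳ n)) ⟩
  sumℤ (map f (upTo n List.∷ʳ n))         ≡⟨ cong sumℤ (LP.map-++ f (upTo n) _) ⟩
  sumℤ (map f (upTo n) ++ f n ∷ [])       ≡⟨ sumℤ-++ (map f (upTo n)) _ ⟩
  ∑< n f + (f n + + 0)                    ≡⟨ cong (_+_ (∑< n f)) (ℤP.+-identityʳ (f n)) ⟩
  ∑< n f + f n                            ∎

∑<-sucˡ : ∀ n f → ∑< (suc n) f ≡ f 0 + ∑< n (f ∘ suc)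
∑<-sucˡ n f = trans (cong (λ l → sumℤ (map f l)) (upTo-suc n))
                    (cong (_+_ (f 0)) (cong sumℤ (sym (LP.map-∘ (upTo n)))))

∏<-suc : ∀ n f → ∏< (suc n) f ≡ ∏< n f * f n
∏<-suc n f = begin
  prodℤ (map f (upTo (suc n)))            ≡⟨ cong (prodℤ ∘ map f) (sym (LP.upTo-∷ʳ n)) ⟩
  prodℤ (map f (upTo n List.∷ʳ n))        ≡⟨ cong prodℤ (LP.map-++ f (upTo n) _) ⟩
  prodℤ (map f (upTo n) ++ f n ∷ [])      ≡⟨ prodℤ-++ (map f (upTo n)) _ ⟩
  ∏< n f * (f n * + 1)                    ≡⟨ cong (∏< n f *_) (ℤP.*-identityʳ (f n)) ⟩
  ∏< n f * f n                            ∎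

∏<-sucˡ : ∀ n f → ∏< (suc n) f ≡ f 0 * ∏< n (f ∘ suc)
∏<-sucˡ n f = trans (cong (λ l → prodℤ (map f l)) (upTo-suc n))
                    (cong (f 0 *_) (cong prodℤ (sym (LP.map-∘ (upTo n)))))

∑<-cong : ∀ n {f g} → (∀ t → t < n → f t ≡ g t) → ∑< n f ≡ ∑< n g
∑<-cong zero    f≡g = refl
∑<-cong (suc n) {f} {g} f≡g = begin
  ∑< (suc n) f  ≡⟨ ∑<-suc n f ⟩
  ∑< n f + f n  ≡⟨ cong₂ _+_ (∑<-cong n (λ t t<n → f≡g t (ℕP.m<n⇒m<1+n t<n))) (f≡g n ℕP.≤-refl) ⟩
  ∑< n g + g n  ≡⟨ ∑<-suc n g ⟨
  ∑< (suc n) g  ∎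

∏<-cong : ∀ n {f g} → (∀ t → t < n → f t ≡ g t) → ∏< n f ≡ ∏< n g
∏<-cong zero    f≡g = refl
∏<-cong (suc n) {f} {g} f≡g = begin
  ∏< (suc n) f  ≡⟨ ∏<-suc n f ⟩
  ∏< n f * f n  ≡⟨ cong₂ _*_ (∏<-cong n (λ t t<n → f≡g t (ℕP.m<n⇒m<1+n t<n))) (f≡g n ℕP.≤-refl) ⟩
  ∏< n g * g n  ≡⟨ ∏<-suc n g ⟨
  ∏< (suc n) g  ∎

∑<-extend : ∀ {n m f} → n ≤ m → (∀ t → n ≤ t → f t ≡ + 0) → ∑< m f ≡ ∑< n f
∑<-extend {n} {m} {f} n≤m vanish =
  trans (cong (λ k → ∑< k f) (sym (ℕP.m∸n+n≡m n≤m))) (padded (m ∸ n))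
  where
  padded : ∀ d → ∑< (d ℕ.+ n) f ≡ ∑< n f
  padded zero    = refl
  padded (suc d) = begin
    ∑< (suc d ℕ.+ n) f               ≡⟨ ∑<-suc (d ℕ.+ n) f ⟩
    ∑< (d ℕ.+ n) f + f (d ℕ.+ n)     ≡⟨ cong₂ _+_ (padded d) (vanish _ (ℕP.m≤n+m n d)) ⟩
    ∑< n f + + 0                     ≡⟨ ℤP.+-identityʳ _ ⟩
    ∑< n f                           ∎

∑<-const : ∀ n c → ∑< n (λ _ → c) ≡ + n * c
∑<-const zero    c = refl
∑<-const (suc n) c = begin
  ∑< (suc n) (λ _ → c)  ≡⟨ ∑<-sucˡ n (λ _ → c) ⟩
  c + ∑< n (λ _ → c)    ≡⟨ cong (_+_ c) (∑<-const n c) ⟩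
  c + + n * c           ≡⟨ distrib c (+ n) ⟩
  + suc n * c           ∎
  where
  distrib : ∀ c n → c + n * c ≡ (+ 1 + n) * c
  distrib = solve-∀

∏<-neg : ∀ n f → ∏< n (λ t → - f t) ≡ -1ℤ ^ n * ∏< n f
∏<-neg zero    f = refl
∏<-neg (suc n) f = begin
  ∏< (suc n) (λ t → - f t)            ≡⟨ ∏<-sucˡ n (λ t → - f t) ⟩
  - f 0 * ∏< n (λ t → - f (suc t))    ≡⟨ cong (- f 0 *_) (∏<-neg n (f ∘ suc)) ⟩
  - f 0 * (-1ℤ ^ n * ∏< n (f ∘ suc))  ≡⟨ rearrange (f 0) (-1ℤ ^ n) _ ⟩
  - (-1ℤ ^ n) * (f 0 * ∏< n (f ∘ suc)) ≡⟨ cong₂ _*_ (sym (ℤP.-1*i≡-i (-1ℤ ^ n))) (sym (∏<-sucˡ n f)) ⟩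
  -1ℤ ^ suc n * ∏< (suc n) f           ∎
  where
  rearrange : ∀ a s p → - a * (s * p) ≡ - s * (a * p)
  rearrange = solve-∀

Π[1⋯]≡∏< : ∀ k g → Π[ 1 ⋯ k ] g ≡ ∏< k (g ∘ suc)
Π[1⋯]≡∏< k g = cong prodℤ (sym (LP.map-∘ (upTo k)))

Π[1⋯]-suc : ∀ k g → Π[ 1 ⋯ suc k ] g ≡ Π[ 1 ⋯ k ] g * g (suc k)
Π[1⋯]-suc k g = begin
  Π[ 1 ⋯ suc k ] g            ≡⟨ Π[1⋯]≡∏< (suc k) g ⟩
  ∏< (suc k) (g ∘ suc)        ≡⟨ ∏<-suc k (g ∘ suc) ⟩
  ∏< k (g ∘ suc) * g (suc k)  ≡⟨ cong (_* g (suc k)) (Π[1⋯]≡∏< k g) ⟨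
  Π[ 1 ⋯ k ] g * g (suc k)    ∎

Π[1⋯]-cong : ∀ k {g h} → (∀ i → 1 ≤ i → i ≤ k → g i ≡ h i) → Π[ 1 ⋯ k ] g ≡ Π[ 1 ⋯ k ] h
Π[1⋯]-cong k {g} {h} g≡h = begin
  Π[ 1 ⋯ k ] g    ≡⟨ Π[1⋯]≡∏< k g ⟩
  ∏< k (g ∘ suc)  ≡⟨ ∏<-cong k (λ t t<k → g≡h (suc t) (s≤s z≤n) t<k) ⟩
  ∏< k (h ∘ suc)  ≡⟨ Π[1⋯]≡∏< k h ⟨
  Π[ 1 ⋯ k ] h    ∎

range-∷ : ∀ {a b} → a ≤ b → range a b ≡ a ∷ range (suc a) b
range-∷ {a} {b} a≤b = begin
  map (a ℕ.+_) (upTo (suc b ∸ a))              ≡⟨ cong (map (a ℕ.+_) ∘ upTo) (ℕP.+-∸-assoc 1 a≤b) ⟩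
  map (a ℕ.+_) (upTo (suc (b ∸ a)))            ≡⟨ cong (map (a ℕ.+_)) (upTo-suc (b ∸ a)) ⟩
  a ℕ.+ 0 ∷ map (a ℕ.+_) (map suc (upTo (b ∸ a)))
    ≡⟨ cong₂ _∷_ (ℕP.+-identityʳ a)
                 (trans (sym (LP.map-∘ (upTo (b ∸ a)))) (LP.map-cong (ℕP.+-suc a) (upTo (b ∸ a)))) ⟩
  a ∷ map (suc a ℕ.+_) (upTo (b ∸ a))          ∎

range1-suc : ∀ K → range 1 (suc K) ≡ range 1 K ++ suc K ∷ []
range1-suc K = trans (cong (map suc) (sym (LP.upTo-∷ʳ K))) (LP.map-++ suc (upTo K) _)

∸-suc-+1 : ∀ {n i} → i < n → n ∸ suc i ℕ.+ 1 ≡ n ∸ i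
∸-suc-+1 {n} {i} i<n = trans (ℕP.+-comm (n ∸ suc i) 1) (sym (ℕP.+-∸-assoc 1 i<n))

Σ[⋯]-top : ∀ n i g → i ≤ n → Σ[ n ∸ i ℕ.+ 1 ⋯ n ] g ≡ ∑< i (λ u → g (n ∸ u))
Σ[⋯]-top n zero    g _ =
  cong (λ k → sumℤ (map g (map (n ℕ.+ 1 ℕ.+_) (upTo k))))
       (ℕP.m≤n⇒m∸n≡0 (ℕP.≤-reflexive (ℕP.+-comm 1 n)))
Σ[⋯]-top n (suc i) g i<n = begin
  Σ[ n ∸ suc i ℕ.+ 1 ⋯ n ] g           ≡⟨ cong (λ a → Σ[ a ⋯ n ] g) (∸-suc-+1 i<n) ⟩
  Σ[ n ∸ i ⋯ n ] g                     ≡⟨ cong (λ l → sumℤ (map g l)) (range-∷ (ℕP.m∸n≤m n i)) ⟩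
  g (n ∸ i) + Σ[ suc (n ∸ i) ⋯ n ] g   ≡⟨ cong (λ a → g (n ∸ i) + Σ[ a ⋯ n ] g) (ℕP.+-comm 1 (n ∸ i)) ⟩
  g (n ∸ i) + Σ[ n ∸ i ℕ.+ 1 ⋯ n ] g   ≡⟨ cong (_+_ (g (n ∸ i))) (Σ[⋯]-top n i g (ℕP.<⇒≤ i<n)) ⟩
  g (n ∸ i) + ∑< i (λ u → g (n ∸ u))   ≡⟨ ℤP.+-comm (g (n ∸ i)) _ ⟩
  ∑< i (λ u → g (n ∸ u)) + g (n ∸ i)   ≡⟨ ∑<-suc i (λ u → g (n ∸ u)) ⟨
  ∑< (suc i) (λ u → g (n ∸ u))         ∎

-- Falling factorials and binomial coefficients

falling-suc : ∀ z k → falling z (suc k) ≡ falling z k * (z - + k)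
falling-suc z k = ∏<-suc k (λ t → z - + t)

falling-sucˡ : ∀ z k → falling z (suc k) ≡ z * falling (z - + 1) k
falling-sucˡ z k = trans (∏<-sucˡ k (λ t → z - + t))
                         (cong₂ _*_ (ℤP.+-identityʳ z) (∏<-cong k (λ t _ → shift z (+ t))))
  where
  shift : ∀ z t → z - (+ 1 + t) ≡ z - + 1 - t
  shift = solve-∀

falling-pascal : ∀ z k → falling (+ 1 + z) (suc k) ≡ falling z (suc k) + + suc k * falling z k
falling-pascal z k = begin
  falling (+ 1 + z) (suc k)                      ≡⟨ falling-sucˡ (+ 1 + z) k ⟩
  (+ 1 + z) * falling (+ 1 + z - + 1) k          ≡⟨ cong (λ u → (+ 1 + z) * falling u k) (cancel z) ⟩
  (+ 1 + z) * falling z k                        ≡⟨ split z (falling z k) (+ k) ⟩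
  falling z k * (z - + k) + + suc k * falling z k ≡⟨ cong (_+ + suc k * falling z k) (falling-suc z k) ⟨
  falling z (suc k) + + suc k * falling z k      ∎
  where
  cancel : ∀ z → + 1 + z - + 1 ≡ z
  cancel = solve-∀
  split : ∀ z F k → (+ 1 + z) * F ≡ F * (z - k) + (+ 1 + k) * F
  split = solve-∀

k!∣falling : ∀ k z → ∃ λ q → falling z k ≡ q * + (k !)
k!∣falling zero    z = + 1 , refl
k!∣falling (suc k)   = multiple
  where
  -- Pascal's rule moves divisibility by (k+1)! between falling z (k+1) and falling (1+z) (k+1),
  -- starting from falling 0 (k+1) = 0.
  Multiple : ℤ → Set
  Multiple z = ∃ λ q → falling z (suc k) ≡ q * + (suc k !)

  pascal : ∀ z → falling (+ 1 + z) (suc k) ≡ falling z (suc k) + proj₁ (k!∣falling k z) * + (suc k !)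
  pascal z with k!∣falling k z
  ... | q , eq = begin
    falling (+ 1 + z) (suc k)                       ≡⟨ falling-pascal z k ⟩
    falling z (suc k) + + suc k * falling z k       ≡⟨ cong (λ u → falling z (suc k) + + suc k * u) eq ⟩
    falling z (suc k) + + suc k * (q * + (k !))     ≡⟨ cong (_+_ (falling z (suc k))) (swap (+ suc k) q _) ⟩
    falling z (suc k) + q * (+ suc k * + (k !))     ≡⟨ cong (λ u → falling z (suc k) + q * u) (ℤP.pos-* (suc k) (k !)) ⟨
    falling z (suc k) + q * + (suc k !)             ∎
    where
    swap : ∀ a q b → a * (q * b) ≡ q * (a * b)
    swap = solve-∀

  up : ∀ z → Multiple z → Multiple (+ 1 + z)
  up z (q , eq) = q + proj₁ (k!∣falling k z) ,
    trans (pascal z) (trans (cong (_+ _) eq) (sym (ℤP.*-distribʳ-+ _ q _)))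

  down : ∀ z → Multiple (+ 1 + z) → Multiple z
  down z (q , eq) = q - q′ , (begin
    falling z (suc k)                      ≡⟨ addSub (falling z (suc k)) (q′ * K) ⟩
    falling z (suc k) + q′ * K - q′ * K    ≡⟨ cong (_- q′ * K) (trans (sym (pascal z)) eq) ⟩
    q * K - q′ * K                         ≡⟨ factor q q′ K ⟩
    (q - q′) * K                           ∎)
    where
    q′ = proj₁ (k!∣falling k z)
    K = + (suc k !)
    addSub : ∀ a b → a ≡ a + b - b
    addSub = solve-∀
    factor : ∀ q q′ K → q * K - q′ * K ≡ (q - q′) * K
    factor = solve-∀

  upward : ∀ n → Multiple (+ n)
  upward zero    = + 0 , refl
  upward (suc n) = up (+ n) (upward n)

  downward : ∀ n → Multiple -[1+ n ]
  downward zero    = down -[1+ 0 ] (upward 0)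
  downward (suc n) = down -[1+ suc n ] (downward n)

  multiple : ∀ z → Multiple z
  multiple (+ n)    = upward n
  multiple -[1+ n ] = downward n

/ℕ-cancelʳ : ∀ q d .{{_ : ℕ.NonZero d}} → (q * + d) /ℕ d ≡ q
/ℕ-cancelʳ (+ m) d = trans (cong (_/ℕ d) (sym (ℤP.pos-* m d))) (cong +_ (ℕD.m*n/n≡m m d))
/ℕ-cancelʳ -[1+ m ] (suc d) with suc (d ℕ.+ m ℕ.* suc d) ℕ.% suc d | ℕD.m*n%n≡0 (suc m) (suc d)
... | zero  | _  = cong (-_ ∘ +_) (ℕD.m*n/n≡m (suc m) (suc d))
... | suc r | ()  -- the other branch of _/ℕ_ needs a nonzero remainder

binom-exact : ∀ z k → binom z k * + (k !) ≡ falling z k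
binom-exact z k with k!∣falling k z
... | q , eq = begin
  (falling z k /ℕ k !) {{k ℕP.!≢0}} * + (k !)  ≡⟨ cong (λ u → (u /ℕ k !) {{k ℕP.!≢0}} * + (k !)) eq ⟩
  (q * + (k !) /ℕ k !) {{k ℕP.!≢0}} * + (k !)  ≡⟨ cong (_* + (k !)) (/ℕ-cancelʳ q (k !) {{k ℕP.!≢0}}) ⟩
  q * + (k !)                                 ≡⟨ eq ⟨
  falling z k                                 ∎

*k!-injective : ∀ k {a b} → a * + (k !) ≡ b * + (k !) → a ≡ b
*k!-injective k {a} {b} = ℤP.*-cancelʳ-≡ a b (+ (k !)) {{k ℕP.!≢0}}

binom-unique : ∀ {z k q} → q * + (k !) ≡ falling z k → binom z k ≡ q
binom-unique {z} {k} eq = *k!-injective k (trans (binom-exact z k) (sym eq))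

binom-absorb : ∀ z k → + suc k * binom z (suc k) ≡ z * binom (z - + 1) k
binom-absorb z k = *k!-injective k (begin
  + suc k * binom z (suc k) * + (k !)      ≡⟨ rearrange (+ suc k) (binom z (suc k)) (+ (k !)) ⟩
  binom z (suc k) * (+ suc k * + (k !))    ≡⟨ cong (binom z (suc k) *_) (ℤP.pos-* (suc k) (k !)) ⟨
  binom z (suc k) * + (suc k !)            ≡⟨ binom-exact z (suc k) ⟩
  falling z (suc k)                        ≡⟨ falling-sucˡ z k ⟩
  z * falling (z - + 1) k                  ≡⟨ cong (z *_) (binom-exact (z - + 1) k) ⟨
  z * (binom (z - + 1) k * + (k !))        ≡⟨ ℤP.*-assoc z _ _ ⟨
  z * binom (z - + 1) k * + (k !)          ∎)
  where
  rearrange : ∀ a b c → a * b * c ≡ b * (a * c)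
  rearrange = solve-∀

vandermonde : ∀ e x y → ∑< (suc e) (λ t → binom x t * binom y (e ∸ t)) ≡ binom (x + y) e
vandermonde zero    x y = refl
vandermonde (suc e) x y = ℤP.*-cancelˡ-≡ (+ E) _ _ (begin
  + E * ∑< (suc E) (λ t → binom x t * binom y (E ∸ t))
    ≡⟨ sum-map-*ˡ (+ E) (upTo (suc E)) (λ t → binom x t * binom y (E ∸ t)) ⟨
  ∑< (suc E) (λ t → + E * (binom x t * binom y (E ∸ t)))
    ≡⟨ ∑<-cong (suc E) splitE ⟩
  ∑< (suc E) (λ t → lower t + upper t)
    ≡⟨ sum-map-+ (upTo (suc E)) lower upper ⟩
  ∑< (suc E) lower + ∑< (suc E) upper
    ≡⟨ cong₂ _+_ lower-sum upper-sum ⟩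
  x * binom (x - + 1 + y) e + y * binom (x + (y - + 1)) e
    ≡⟨ cong₂ (λ a b → x * binom a e + y * binom b e) (shiftˡ x y) (shiftʳ x y) ⟩
  x * binom (x + y - + 1) e + y * binom (x + y - + 1) e
    ≡⟨ ℤP.*-distribʳ-+ (binom (x + y - + 1) e) x y ⟨
  (x + y) * binom (x + y - + 1) e
    ≡⟨ binom-absorb (x + y) e ⟨
  + E * binom (x + y) E ∎)
  where
  E = suc e
  lower upper : ℕ → ℤ
  lower t = + t * binom x t * binom y (E ∸ t)
  upper t = binom x t * (+ (E ∸ t) * binom y (E ∸ t))

  shiftˡ : ∀ x y → x - + 1 + y ≡ x + y - + 1
  shiftˡ = solve-∀
  shiftʳ : ∀ x y → x + (y - + 1) ≡ x + y - + 1
  shiftʳ = solve-∀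

  splitE : ∀ t → t < suc E → + E * (binom x t * binom y (E ∸ t)) ≡ lower t + upper t
  splitE t t≤E = begin
    + E * (binom x t * binom y (E ∸ t))
      ≡⟨ cong (λ u → + u * (binom x t * binom y (E ∸ t))) (ℕP.m+[n∸m]≡n (ℕP.≤-pred t≤E)) ⟨
    (+ t + + (E ∸ t)) * (binom x t * binom y (E ∸ t))
      ≡⟨ distrib (+ t) (+ (E ∸ t)) (binom x t) (binom y (E ∸ t)) ⟩
    lower t + upper t ∎
    where
    distrib : ∀ a b c d → (a + b) * (c * d) ≡ a * c * d + c * (b * d)
    distrib = solve-∀

  lower-sum : ∑< (suc E) lower ≡ x * binom (x - + 1 + y) e
  lower-sum = begin
    ∑< (suc E) lower
      ≡⟨ ∑<-sucˡ E lower ⟩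
    + 0 + ∑< E (lower ∘ suc)
      ≡⟨ ℤP.+-identityˡ _ ⟩
    ∑< E (λ t → + suc t * binom x (suc t) * binom y (e ∸ t))
      ≡⟨ ∑<-cong E (λ t _ → cong (_* binom y (e ∸ t)) (binom-absorb x t)) ⟩
    ∑< E (λ t → x * binom (x - + 1) t * binom y (e ∸ t))
      ≡⟨ ∑<-cong E (λ t _ → ℤP.*-assoc x (binom (x - + 1) t) (binom y (e ∸ t))) ⟩
    ∑< E (λ t → x * (binom (x - + 1) t * binom y (e ∸ t)))
      ≡⟨ sum-map-*ˡ x (upTo E) (λ t → binom (x - + 1) t * binom y (e ∸ t)) ⟩
    x * ∑< E (λ t → binom (x - + 1) t * binom y (e ∸ t))
      ≡⟨ cong (x *_) (vandermonde e (x - + 1) y) ⟩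
    x * binom (x - + 1 + y) e ∎

  upper-sum : ∑< (suc E) upper ≡ y * binom (x + (y - + 1)) e
  upper-sum = begin
    ∑< (suc E) upper
      ≡⟨ ∑<-suc E upper ⟩
    ∑< E upper + upper E
      ≡⟨ cong (λ u → ∑< E upper + binom x E * (+ u * binom y u)) (ℕP.n∸n≡0 E) ⟩
    ∑< E upper + binom x E * + 0
      ≡⟨ trans (cong (_+_ (∑< E upper)) (ℤP.*-zeroʳ (binom x E))) (ℤP.+-identityʳ _) ⟩
    ∑< E upper
      ≡⟨ ∑<-cong E absorbed ⟩
    ∑< E (λ t → y * (binom x t * binom (y - + 1) (e ∸ t)))
      ≡⟨ sum-map-*ˡ y (upTo E) (λ t → binom x t * binom (y - + 1) (e ∸ t)) ⟩
    y * ∑< E (λ t → binom x t * binom (y - + 1) (e ∸ t))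
      ≡⟨ cong (y *_) (vandermonde e x (y - + 1)) ⟩
    y * binom (x + (y - + 1)) e ∎
    where
    absorbed : ∀ t → t < E → upper t ≡ y * (binom x t * binom (y - + 1) (e ∸ t))
    absorbed t t<E = begin
      binom x t * (+ (E ∸ t) * binom y (E ∸ t))
        ≡⟨ cong (λ u → binom x t * (+ u * binom y u)) (ℕP.+-∸-assoc 1 (ℕP.≤-pred t<E)) ⟩
      binom x t * (+ suc (e ∸ t) * binom y (suc (e ∸ t)))
        ≡⟨ cong (binom x t *_) (binom-absorb y (e ∸ t)) ⟩
      binom x t * (y * binom (y - + 1) (e ∸ t))
        ≡⟨ ℤP.*-comm (binom x t) _ ⟩
      y * binom (y - + 1) (e ∸ t) * binom x t
        ≡⟨ ℤP.*-assoc y _ _ ⟩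
      y * (binom (y - + 1) (e ∸ t) * binom x t)
        ≡⟨ cong (y *_) (ℤP.*-comm _ (binom x t)) ⟩
      y * (binom x t * binom (y - + 1) (e ∸ t)) ∎

-1^-square : ∀ n → -1ℤ ^ n * -1ℤ ^ n ≡ + 1
-1^-square zero    = refl
-1^-square (suc n) = begin
  -1ℤ * -1ℤ ^ n * (-1ℤ * -1ℤ ^ n)  ≡⟨ cong₂ _*_ (ℤP.-1*i≡-i (-1ℤ ^ n)) (ℤP.-1*i≡-i (-1ℤ ^ n)) ⟩
  - (-1ℤ ^ n) * - (-1ℤ ^ n)        ≡⟨ negSquare (-1ℤ ^ n) ⟩
  -1ℤ ^ n * -1ℤ ^ n                ≡⟨ -1^-square n ⟩
  + 1                              ∎
  where
  negSquare : ∀ s → - s * - s ≡ s * s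
  negSquare = solve-∀

-1^-flip : ∀ n {a b} → a ≡ -1ℤ ^ n * b → b ≡ -1ℤ ^ n * a
-1^-flip n {a} {b} a≡±b = begin
  b                            ≡⟨ ℤP.*-identityˡ b ⟨
  + 1 * b                      ≡⟨ cong (_* b) (-1^-square n) ⟨
  -1ℤ ^ n * -1ℤ ^ n * b        ≡⟨ ℤP.*-assoc (-1ℤ ^ n) _ _ ⟩
  -1ℤ ^ n * (-1ℤ ^ n * b)      ≡⟨ cong (-1ℤ ^ n *_) a≡±b ⟨
  -1ℤ ^ n * a                  ∎

falling-neg : ∀ w y → falling (- w) y ≡ -1ℤ ^ y * falling (w + + y - + 1) y
falling-neg w zero    = refl
falling-neg w (suc y) = begin
  falling (- w) (suc y)
    ≡⟨ falling-suc (- w) y ⟩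
  falling (- w) y * (- w - + y)
    ≡⟨ cong (_* (- w - + y)) (falling-neg w y) ⟩
  -1ℤ ^ y * falling (w + + y - + 1) y * (- w - + y)
    ≡⟨ cong (λ u → -1ℤ ^ y * falling u y * (- w - + y)) (shift w (+ y)) ⟩
  -1ℤ ^ y * falling (z - + 1) y * (- w - + y)
    ≡⟨ rearrange (-1ℤ ^ y) (falling (z - + 1) y) w (+ y) ⟩
  - (-1ℤ ^ y) * (z * falling (z - + 1) y)
    ≡⟨ cong₂ _*_ (ℤP.-1*i≡-i (-1ℤ ^ y)) (falling-sucˡ z y) ⟨
  -1ℤ ^ suc y * falling z (suc y) ∎
  where
  z = w + + suc y - + 1
  shift : ∀ w y → w + y - + 1 ≡ w + (+ 1 + y) - + 1 - + 1
  shift = solve-∀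
  rearrange : ∀ s F w y → s * F * (- w - y) ≡ - s * ((w + (+ 1 + y) - + 1) * F)
  rearrange = solve-∀

binom-reflect : ∀ w y → binom (w + + y - + 1) y ≡ -1ℤ ^ y * binom (- w) y
binom-reflect w y = -1^-flip y (*k!-injective y (begin
  binom (- w) y * + (y !)                  ≡⟨ binom-exact (- w) y ⟩
  falling (- w) y                          ≡⟨ falling-neg w y ⟩
  -1ℤ ^ y * falling (w + + y - + 1) y      ≡⟨ cong (-1ℤ ^ y *_) (binom-exact (w + + y - + 1) y) ⟨
  -1ℤ ^ y * (binom (w + + y - + 1) y * + (y !)) ≡⟨ ℤP.*-assoc (-1ℤ ^ y) _ _ ⟨
  -1ℤ ^ y * binom (w + + y - + 1) y * + (y !)   ∎))

binom-reflect₂ : ∀ c y → binom (c + + y - + 2) y ≡ -1ℤ ^ y * binom (+ 1 - c) y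
binom-reflect₂ c y = begin
  binom (c + + y - + 2) y              ≡⟨ cong (λ u → binom u y) (shift c (+ y)) ⟩
  binom (c - + 1 + + y - + 1) y        ≡⟨ binom-reflect (c - + 1) y ⟩
  -1ℤ ^ y * binom (- (c - + 1)) y      ≡⟨ cong (λ u → -1ℤ ^ y * binom u y) (negate c) ⟩
  -1ℤ ^ y * binom (+ 1 - c) y          ∎
  where
  shift : ∀ c y → c + y - + 2 ≡ c - + 1 + y - + 1
  shift = solve-∀
  negate : ∀ c → - (c - + 1) ≡ + 1 - c
  negate = solve-∀

reflectedUpper : ℕ → ℤ → ℤ
reflectedUpper (suc zero) c = - (c + + 1)
reflectedUpper _          c = + 1 - c

factor₂-reflect : ∀ i c y → factor₂ i c y ≡ -1ℤ ^ y * binom (reflectedUpper i (+ c)) y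
factor₂-reflect (suc zero)    c y =
  trans (cong (λ u → binom u y) (shift (+ c) (+ y))) (binom-reflect (+ c + + 1) y)
  where
  shift : ∀ c y → c + y ≡ c + + 1 + y - + 1
  shift = solve-∀
factor₂-reflect zero          c y = binom-reflect₂ (+ c) y
factor₂-reflect (suc (suc _)) c y = binom-reflect₂ (+ c) y

-- The lower index lives in ℤ (with value 0 below 0), so that shifting a total by t needs no case split.
binomℤ : ℤ → ℤ → ℤ
binomℤ y (+ e)    = binom y e
binomℤ y -[1+ _ ] = + 0

binomℤ-0ˡ : ∀ d → binomℤ (+ 0) d ≡ 𝟙 (+ 0 ℤ.≟ d)
binomℤ-0ˡ (+ zero)  = refl
binomℤ-0ˡ (+ suc e) = binom-unique {+ 0} {suc e} (sym (falling-sucˡ (+ 0) e))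
binomℤ-0ˡ -[1+ _ ]  = refl

binomℤ-absorb : ∀ z d → d * binomℤ z d ≡ z * binomℤ (z - + 1) (d - + 1)
binomℤ-absorb z (+ zero)  = sym (ℤP.*-zeroʳ z)
binomℤ-absorb z (+ suc e) =
  trans (binom-absorb z e) (cong (λ d → z * binomℤ (z - + 1) d) (predecessor (+ e)))
  where
  predecessor : ∀ e → e ≡ + 1 + e - + 1
  predecessor = solve-∀
binomℤ-absorb z -[1+ n ]  = trans (ℤP.*-zeroʳ -[1+ n ]) (sym (ℤP.*-zeroʳ z))

binomℤ-below : ∀ y {e t} → e < t → binomℤ y (+ e - + t) ≡ + 0
binomℤ-below y {e} {t} e<t = cong (binomℤ y)
  (trans (ℤP.m-n≡m⊖n e t) (trans (ℤP.⊖-< e<t) (cong (-_ ∘ +_) (ℕP.+-∸-assoc 1 e<t))))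

binomℤ-above : ∀ y {e t} → t ≤ e → binomℤ y (+ e - + t) ≡ binom y (e ∸ t)
binomℤ-above y {e} {t} t≤e = cong (binomℤ y) (trans (ℤP.m-n≡m⊖n e t) (ℤP.⊖-≥ t≤e))

vandermondeℤ : ∀ b x y d → d ℤ.≤ + b →
               ∑< (suc b) (λ t → binom x t * binomℤ y (d - + t)) ≡ binomℤ (x + y) d
vandermondeℤ b x y -[1+ n ] _ = sum-map-0 (upTo (suc b)) _ vanish
  where
  vanish : ∀ t → binom x t * binomℤ y (-[1+ n ] - + t) ≡ + 0
  vanish zero    = ℤP.*-zeroʳ (binom x 0)
  vanish (suc t) = ℤP.*-zeroʳ (binom x (suc t))
vandermondeℤ b x y (+ e) (ℤ.+≤+ e≤b) = begin
  ∑< (suc b) (λ t → binom x t * binomℤ y (+ e - + t))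
    ≡⟨ ∑<-extend (s≤s e≤b) (λ t e<t → trans (cong (binom x t *_) (binomℤ-below y e<t))
                                             (ℤP.*-zeroʳ (binom x t))) ⟩
  ∑< (suc e) (λ t → binom x t * binomℤ y (+ e - + t))
    ≡⟨ ∑<-cong (suc e) (λ t t≤e → cong (binom x t *_) (binomℤ-above y (ℕP.≤-pred t≤e))) ⟩
  ∑< (suc e) (λ t → binom x t * binom y (e ∸ t))
    ≡⟨ vandermonde e x y ⟩
  binom (x + y) e ∎

-- Boxes, compositions and weights

box-∷ʳ : ∀ b k (g : Vec ℕ (suc k) → ℤ) →
         sumℤ (map g (box b (suc k))) ≡ ∑< (suc b) (λ t → sumℤ (map (λ v → g (v ∷ʳ t)) (box b k)))
box-∷ʳ b zero    g = sum-concatMap (upTo (suc b)) (λ x → map (x Vec.∷_) (Vec.[] ∷ [])) g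
box-∷ʳ b (suc k) g = begin
  sumℤ (map g (concatMap (λ x → map (x Vec.∷_) (box b (suc k))) (upTo (suc b))))
    ≡⟨ sum-concatMap (upTo (suc b)) (λ x → map (x Vec.∷_) (box b (suc k))) g ⟩
  ∑< (suc b) (λ x → sumℤ (map g (map (x Vec.∷_) (box b (suc k)))))
    ≡⟨ cong sumℤ (LP.map-cong (λ x → cong sumℤ (sym (LP.map-∘ (box b (suc k))))) (upTo (suc b))) ⟩
  ∑< (suc b) (λ x → sumℤ (map (λ w → g (x Vec.∷ w)) (box b (suc k))))
    ≡⟨ cong sumℤ (LP.map-cong (λ x → box-∷ʳ b k (λ w → g (x Vec.∷ w))) (upTo (suc b))) ⟩
  ∑< (suc b) (λ x → ∑< (suc b) (λ t → sumℤ (map (λ v → g (x Vec.∷ (v ∷ʳ t))) (box b k))))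
    ≡⟨ sum-swap (upTo (suc b)) (upTo (suc b)) (λ x t → sumℤ (map (λ v → g (x Vec.∷ (v ∷ʳ t))) (box b k))) ⟩
  ∑< (suc b) (λ t → ∑< (suc b) (λ x → sumℤ (map (λ v → g ((x Vec.∷ v) ∷ʳ t)) (box b k))))
    ≡⟨ cong sumℤ (LP.map-cong (λ t → sym (regroup t)) (upTo (suc b))) ⟩
  ∑< (suc b) (λ t → sumℤ (map (λ v → g (v ∷ʳ t)) (box b (suc k)))) ∎
  where
  regroup : ∀ t → sumℤ (map (λ v → g (v ∷ʳ t)) (box b (suc k))) ≡
                  ∑< (suc b) (λ x → sumℤ (map (λ v → g ((x Vec.∷ v) ∷ʳ t)) (box b k)))
  regroup t = trans (sum-concatMap (upTo (suc b)) (λ x → map (x Vec.∷_) (box b k)) (λ v → g (v ∷ʳ t)))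
                    (cong sumℤ (LP.map-cong (λ x → cong sumℤ (sym (LP.map-∘ (box b k)))) (upTo (suc b))))

∷ʳ-⟨⟩ : ∀ {k} (v : Vec ℕ k) t i → 1 ≤ i → i ≤ k → (v ∷ʳ t) ⟨ i ⟩ ≡ v ⟨ i ⟩
∷ʳ-⟨⟩ v           t zero          () _
∷ʳ-⟨⟩ Vec.[]      t (suc i)       _  ()
∷ʳ-⟨⟩ (x Vec.∷ v) t (suc zero)    _  _         = refl
∷ʳ-⟨⟩ (x Vec.∷ v) t (suc (suc i)) _  (s≤s i≤k) = ∷ʳ-⟨⟩ v t (suc i) (s≤s z≤n) i≤k

∷ʳ-⟨last⟩ : ∀ {k} (v : Vec ℕ k) t → (v ∷ʳ t) ⟨ suc k ⟩ ≡ t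
∷ʳ-⟨last⟩ Vec.[]      t = refl
∷ʳ-⟨last⟩ (x Vec.∷ v) t = ∷ʳ-⟨last⟩ v t

psum-∷ʳ : ∀ {k} (v : Vec ℕ k) t i → i ≤ k → psum (v ∷ʳ t) i ≡ psum v i
psum-∷ʳ v           t zero    _         = refl
psum-∷ʳ Vec.[]      t (suc i) ()
psum-∷ʳ (x Vec.∷ v) t (suc i) (s≤s i≤k) = cong (x ℕ.+_) (psum-∷ʳ v t i i≤k)

psum-all : ∀ {k} (v : Vec ℕ k) → psum v k ≡ sumℕ (toList v)
psum-all Vec.[]      = refl
psum-all (x Vec.∷ v) = cong (x ℕ.+_) (psum-all v)

sum-∷ʳ : ∀ {k} (v : Vec ℕ k) t → sumℕ (toList (v ∷ʳ t)) ≡ sumℕ (toList v) ℕ.+ t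
sum-∷ʳ Vec.[]      t = ℕP.+-identityʳ t
sum-∷ʳ (x Vec.∷ v) t = trans (cong (x ℕ.+_) (sum-∷ʳ v t)) (sym (ℕP.+-assoc x _ t))

psum-mono : ∀ {k} (v : Vec ℕ k) i → psum v i ≤ psum v (suc i)
psum-mono Vec.[]      zero    = z≤n
psum-mono Vec.[]      (suc i) = z≤n
psum-mono (x Vec.∷ v) zero    = z≤n
psum-mono (x Vec.∷ v) (suc i) = ℕP.+-monoʳ-≤ x (psum-mono v i)

Π[1⋯]-^ : ∀ c {m} (j : Vec ℕ m) → Π[ 1 ⋯ m ] (λ i → c ^ (j ⟨ i ⟩)) ≡ c ^ sumℕ (toList j)
Π[1⋯]-^ c Vec.[]              = refl
Π[1⋯]-^ c {suc m} (h Vec.∷ j) = begin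
  Π[ 1 ⋯ suc m ] (λ i → c ^ ((h Vec.∷ j) ⟨ i ⟩))     ≡⟨ Π[1⋯]≡∏< (suc m) (λ i → c ^ ((h Vec.∷ j) ⟨ i ⟩)) ⟩
  ∏< (suc m) (λ t → c ^ ((h Vec.∷ j) ⟨ suc t ⟩))    ≡⟨ ∏<-sucˡ m (λ t → c ^ ((h Vec.∷ j) ⟨ suc t ⟩)) ⟩
  c ^ h * ∏< m (λ t → c ^ (j ⟨ suc t ⟩))            ≡⟨ cong (c ^ h *_) (Π[1⋯]≡∏< m (λ i → c ^ (j ⟨ i ⟩))) ⟨
  c ^ h * Π[ 1 ⋯ m ] (λ i → c ^ (j ⟨ i ⟩))           ≡⟨ cong (c ^ h *_) (Π[1⋯]-^ c j) ⟩
  c ^ h * c ^ sumℕ (toList j)                       ≡⟨ ℤP.^-distribˡ-+-* c h _ ⟨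
  c ^ sumℕ (toList (h Vec.∷ j))                     ∎

weightFactor : ∀ {m} → Vec ℕ m → ℕ → ℤ
weightFactor j i = + psum j i - + i + + 1

-- At the first K with psum j K < K we have psum j K = K - 1, because psum j is monotone
-- and psum j (K - 1) ≥ K - 1; so the weight factor at K is 0.
prefix-or-weight≡0 : ∀ {m} (j : Vec ℕ m) K →
  (All (λ k → k ≤ psum j k) (range 1 K) × K ≤ psum j K) ⊎ Π[ 1 ⋯ K ] (weightFactor j) ≡ + 0
prefix-or-weight≡0 j zero = inj₁ ([] , z≤n)
prefix-or-weight≡0 j (suc K) with prefix-or-weight≡0 j K
... | inj₂ w≡0 = inj₂ (trans (Π[1⋯]-suc K (weightFactor j)) (cong (_* weightFactor j (suc K)) w≡0))
... | inj₁ (prefix , K≤) with suc K ℕ.≤? psum j (suc K)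
...   | yes K<   = inj₁ (subst (All _) (sym (range1-suc K)) (AllP.++⁺ prefix (K< ∷ [])) , K<)
...   | no K≮ = inj₂ (begin
  Π[ 1 ⋯ suc K ] (weightFactor j)  ≡⟨ Π[1⋯]-suc K (weightFactor j) ⟩
  W * weightFactor j (suc K)        ≡⟨ cong (λ p → W * (+ p - + suc K + + 1)) stalled ⟩
  W * (+ K - + suc K + + 1)         ≡⟨ cong (W *_) (vanish (+ K)) ⟩
  W * + 0                           ≡⟨ ℤP.*-zeroʳ W ⟩
  + 0                               ∎)
  where
  W = Π[ 1 ⋯ K ] (weightFactor j)
  stalled : psum j (suc K) ≡ K
  stalled = ℕP.≤-antisym (ℕP.≤-pred (ℕP.≰⇒> K≮)) (ℕP.≤-trans K≤ (psum-mono j K))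
  vanish : ∀ K → K - (+ 1 + K) + + 1 ≡ + 0
  vanish = solve-∀

weight≡0 : ∀ m (j : Vec ℕ m) → ¬ All (λ k → k ≤ psum j k) (range 1 m) → weight m j ≡ + 0
weight≡0 m j ¬prefix with prefix-or-weight≡0 j m
... | inj₁ (prefix , _) = ⊥-elim (¬prefix prefix)
... | inj₂ w≡0          = w≡0

-- The product formula

module _ (x : ℕ → ℤ) where

  partialSum : ℕ → ℤ
  partialSum k = ∑< k (x ∘ suc)

  partialProduct : ℕ → ℤ
  partialProduct k = ∏< k (λ t → partialSum (suc t) - + t)

  binomTerm : (k : ℕ) → Vec ℕ k → ℤ
  binomTerm k j = Π[ 1 ⋯ k ] (λ i → binom (x i) (j ⟨ i ⟩)) * weight k j

  binomTerm-∷ʳ : ∀ k (v : Vec ℕ k) t →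
    binomTerm (suc k) (v ∷ʳ t) ≡
    binomTerm k v * (binom (x (suc k)) t * (+ sumℕ (toList v) + + t - + suc k + + 1))
  binomTerm-∷ʳ k v t = begin
    binomTerm (suc k) w
      ≡⟨ cong₂ _*_ (Π[1⋯]-suc k (λ i → binom (x i) (w ⟨ i ⟩))) (Π[1⋯]-suc k (weightFactor w)) ⟩
    Binoms w * binom (x (suc k)) (w ⟨ suc k ⟩) * (Weights w * weightFactor w (suc k))
      ≡⟨ cong₂ (λ B c → B * binom (x (suc k)) c * (Weights w * weightFactor w (suc k)))
               (Π[1⋯]-cong k (λ i 1≤i i≤k → cong (binom (x i)) (∷ʳ-⟨⟩ v t i 1≤i i≤k)))
               (∷ʳ-⟨last⟩ v t) ⟩
    Binoms v * binom (x (suc k)) t * (Weights w * weightFactor w (suc k))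
      ≡⟨ cong₂ (λ W p → Binoms v * binom (x (suc k)) t * (W * (+ p - + suc k + + 1)))
               (Π[1⋯]-cong k (λ i _ i≤k → cong (λ p → + p - + i + + 1) (psum-∷ʳ v t i i≤k)))
               (trans (psum-all w) (sum-∷ʳ v t)) ⟩
    Binoms v * binom (x (suc k)) t * (Weights v * (+ sumℕ (toList v) + + t - + suc k + + 1))
      ≡⟨ interchange (Binoms v) (binom (x (suc k)) t) (Weights v) _ ⟩
    binomTerm k v * (binom (x (suc k)) t * (+ sumℕ (toList v) + + t - + suc k + + 1)) ∎
    where
    w = v ∷ʳ t
    Binoms Weights : ∀ {n} → Vec ℕ n → ℤ
    Binoms u = Π[ 1 ⋯ k ] (λ i → binom (x i) (u ⟨ i ⟩))
    Weights u = Π[ 1 ⋯ k ] (weightFactor u)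
    interchange : ∀ a b c d → a * b * (c * d) ≡ a * c * (b * d)
    interchange = solve-∀

  fiberSum : ℕ → (k : ℕ) → ℤ → ℤ
  fiberSum b k N = sumℤ (map (λ j → 𝟙 (+ sumℕ (toList j) ℤ.≟ N) * binomTerm k j) (box b k))

  fiberSum-∷ʳ : ∀ b k N t → sumℤ (map (λ v → 𝟙 (+ sumℕ (toList (v ∷ʳ t)) ℤ.≟ N) * binomTerm (suc k) (v ∷ʳ t)) (box b k))
                          ≡ binom (x (suc k)) t * (N - + k) * fiberSum b k (N - + t)
  fiberSum-∷ʳ b k N t =
    trans (cong sumℤ (LP.map-cong peel (box b k)))
          (sum-map-*ˡ (binom (x (suc k)) t * (N - + k)) (box b k)
                      (λ v → 𝟙 (+ sumℕ (toList v) ℤ.≟ N - + t) * binomTerm k v))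
    where
    peel : ∀ v → 𝟙 (+ sumℕ (toList (v ∷ʳ t)) ℤ.≟ N) * binomTerm (suc k) (v ∷ʳ t) ≡
                 binom (x (suc k)) t * (N - + k) * (𝟙 (+ sumℕ (toList v) ℤ.≟ N - + t) * binomTerm k v)
    peel v = begin
      𝟙 (+ sumℕ (toList (v ∷ʳ t)) ℤ.≟ N) * binomTerm (suc k) (v ∷ʳ t)
        ≡⟨ cong₂ (λ a T → 𝟙 (+ a ℤ.≟ N) * T) (sum-∷ʳ v t) (binomTerm-∷ʳ k v t) ⟩
      𝟙 (A + + t ℤ.≟ N) * (T * (B * (A + + t - + suc k + + 1)))
        ≡⟨ 𝟙-≟-subst {A + + t} {N} (λ a → T * (B * (a - + suc k + + 1))) ⟩
      𝟙 (A + + t ℤ.≟ N) * (T * (B * (N - + suc k + + 1)))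
        ≡⟨ cong (_* (T * (B * (N - + suc k + + 1)))) (𝟙-≟-shift A (+ t) N) ⟩
      𝟙 (A ℤ.≟ N - + t) * (T * (B * (N - + suc k + + 1)))
        ≡⟨ regroup (𝟙 (A ℤ.≟ N - + t)) T B N (+ k) ⟩
      B * (N - + k) * (𝟙 (A ℤ.≟ N - + t) * T) ∎
      where
      A = + sumℕ (toList v)
      T = binomTerm k v
      B = binom (x (suc k)) t
      regroup : ∀ I T B N K → I * (T * (B * (N - (+ 1 + K) + + 1))) ≡ B * (N - K) * (I * T)
      regroup = solve-∀

  partialProduct-absorb : ∀ k N →
    (N - + k) * partialProduct k * binomℤ (x (suc k) + (partialSum k - + k)) (N - + k) ≡
    partialProduct (suc k) * binomℤ (partialSum (suc k) - + suc k) (N - + suc k)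
  partialProduct-absorb k N = begin
    (N - + k) * P * binomℤ z (N - + k)
      ≡⟨ rearrange (N - + k) P _ ⟩
    P * ((N - + k) * binomℤ z (N - + k))
      ≡⟨ cong (P *_) (binomℤ-absorb z (N - + k)) ⟩
    P * (z * binomℤ (z - + 1) (N - + k - + 1))
      ≡⟨ cong (P *_) (cong₂ (λ a b → a * binomℤ b (N - + k - + 1)) z≡ z-1≡) ⟩
    P * ((partialSum (suc k) - + k) * binomℤ (partialSum (suc k) - + suc k) (N - + k - + 1))
      ≡⟨ cong (λ d → P * ((partialSum (suc k) - + k) * binomℤ (partialSum (suc k) - + suc k) d)) (subSub N (+ k)) ⟩
    P * ((partialSum (suc k) - + k) * binomℤ (partialSum (suc k) - + suc k) (N - + suc k))
      ≡⟨ ℤP.*-assoc P _ _ ⟨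
    P * (partialSum (suc k) - + k) * binomℤ (partialSum (suc k) - + suc k) (N - + suc k)
      ≡⟨ cong (_* binomℤ (partialSum (suc k) - + suc k) (N - + suc k)) (∏<-suc k _) ⟨
    partialProduct (suc k) * binomℤ (partialSum (suc k) - + suc k) (N - + suc k) ∎
    where
    P = partialProduct k
    z = x (suc k) + (partialSum k - + k)
    rearrange : ∀ a P c → a * P * c ≡ P * (a * c)
    rearrange = solve-∀
    subSub : ∀ N K → N - K - + 1 ≡ N - (+ 1 + K)
    subSub = solve-∀
    z≡ : z ≡ partialSum (suc k) - + k
    z≡ = trans (moveSub (x (suc k)) (partialSum k) (+ k)) (cong (_- + k) (sym (∑<-suc k (x ∘ suc))))
      where
      moveSub : ∀ x S K → x + (S - K) ≡ S + x - K
      moveSub = solve-∀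
    z-1≡ : z - + 1 ≡ partialSum (suc k) - + suc k
    z-1≡ = trans (moveSub (x (suc k)) (partialSum k) (+ k)) (cong (_- + suc k) (sym (∑<-suc k (x ∘ suc))))
      where
      moveSub : ∀ x S K → x + (S - K) - + 1 ≡ S + x - (+ 1 + K)
      moveSub = solve-∀

  fiberSum-closed : ∀ b k N → N ℤ.≤ + b →
    fiberSum b k N ≡ partialProduct k * binomℤ (partialSum k - + k) (N - + k)
  fiberSum-closed b zero N _ = begin
    𝟙 (+ 0 ℤ.≟ N) * + 1 + + 0   ≡⟨ ℤP.+-identityʳ _ ⟩
    𝟙 (+ 0 ℤ.≟ N) * + 1         ≡⟨ ℤP.*-identityʳ _ ⟩
    𝟙 (+ 0 ℤ.≟ N)               ≡⟨ binomℤ-0ˡ N ⟨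
    binomℤ (+ 0) N              ≡⟨ cong (binomℤ (+ 0)) (ℤP.+-identityʳ N) ⟨
    binomℤ (+ 0) (N - + 0)      ≡⟨ ℤP.*-identityˡ _ ⟨
    + 1 * binomℤ (+ 0) (N - + 0) ∎
  fiberSum-closed b (suc k) N N≤b = begin
    fiberSum b (suc k) N
      ≡⟨ box-∷ʳ b k _ ⟩
    ∑< (suc b) (λ t → sumℤ (map (λ v → 𝟙 (+ sumℕ (toList (v ∷ʳ t)) ℤ.≟ N) * binomTerm (suc k) (v ∷ʳ t)) (box b k)))
      ≡⟨ ∑<-cong (suc b) (λ t _ → fiberSum-∷ʳ b k N t) ⟩
    ∑< (suc b) (λ t → binom x′ t * (N - + k) * fiberSum b k (N - + t))
      ≡⟨ ∑<-cong (suc b) (λ t _ → cong (binom x′ t * (N - + k) *_)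
                                       (fiberSum-closed b k (N - + t) (ℤP.i≤j⇒i-k≤j (+ t) N≤b))) ⟩
    ∑< (suc b) (λ t → binom x′ t * (N - + k) * (P * binomℤ Y (N - + t - + k)))
      ≡⟨ ∑<-cong (suc b) (λ t _ → regroup t) ⟩
    ∑< (suc b) (λ t → (N - + k) * P * (binom x′ t * binomℤ Y (N - + k - + t)))
      ≡⟨ sum-map-*ˡ ((N - + k) * P) (upTo (suc b)) (λ t → binom x′ t * binomℤ Y (N - + k - + t)) ⟩
    (N - + k) * P * ∑< (suc b) (λ t → binom x′ t * binomℤ Y (N - + k - + t))
      ≡⟨ cong ((N - + k) * P *_) (vandermondeℤ b x′ Y (N - + k) (ℤP.i≤j⇒i-k≤j (+ k) N≤b)) ⟩
    (N - + k) * P * binomℤ (x′ + Y) (N - + k)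
      ≡⟨ partialProduct-absorb k N ⟩
    partialProduct (suc k) * binomℤ (partialSum (suc k) - + suc k) (N - + suc k) ∎
    where
    x′ = x (suc k)
    P = partialProduct k
    Y = partialSum k - + k
    regroup : ∀ t → binom x′ t * (N - + k) * (P * binomℤ Y (N - + t - + k)) ≡
                    (N - + k) * P * (binom x′ t * binomℤ Y (N - + k - + t))
    regroup t = trans (cong (λ d → binom x′ t * (N - + k) * (P * binomℤ Y d)) (subSwap N (+ t) (+ k)))
                      (rearrange (binom x′ t) (N - + k) P _)
      where
      subSwap : ∀ N t k → N - t - k ≡ N - k - t
      subSwap = solve-∀
      rearrange : ∀ b a P c → b * a * (P * c) ≡ a * P * (b * c)
      rearrange = solve-∀

  Σcomp-binomTerm : ∀ m → Σcomp m (binomTerm m) ≡ partialProduct m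
  Σcomp-binomTerm m = begin
    Σcomp m (binomTerm m)
      ≡⟨ sum-filter (validComp? m) (box m m) (binomTerm m) ⟩
    sumℤ (map (λ j → 𝟙 (validComp? m j) * binomTerm m j) (box m m))
      ≡⟨ cong sumℤ (LP.map-cong validComp≡fiber (box m m)) ⟩
    fiberSum m m (+ m)
      ≡⟨ fiberSum-closed m m (+ m) ℤP.≤-refl ⟩
    partialProduct m * binomℤ (partialSum m - + m) (+ m - + m)
      ≡⟨ cong (λ d → partialProduct m * binomℤ (partialSum m - + m) d) (ℤP.+-inverseʳ (+ m)) ⟩
    partialProduct m * + 1
      ≡⟨ ℤP.*-identityʳ _ ⟩
    partialProduct m ∎
    where
    validComp≡fiber : ∀ j → 𝟙 (validComp? m j) * binomTerm m j ≡ 𝟙 (+ sumℕ (toList j) ℤ.≟ + m) * binomTerm m j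
    validComp≡fiber j with validComp? m j | + sumℕ (toList j) ℤ.≟ + m
    ... | yes _           | yes _  = refl
    ... | no _            | no _   = refl
    ... | yes (Σj≡m , _)  | no Σj≢m = ⊥-elim (Σj≢m (cong +_ Σj≡m))
    ... | no ¬valid       | yes Σj≡m = sym (begin
      + 1 * (Binoms * weight m j)  ≡⟨ ℤP.*-identityˡ _ ⟩
      Binoms * weight m j          ≡⟨ cong (Binoms *_) (weight≡0 m j (λ prefix → ¬valid (ℤP.+-injective Σj≡m , prefix))) ⟩
      Binoms * + 0                 ≡⟨ ℤP.*-zeroʳ Binoms ⟩
      + 0                          ∎)
      where
      Binoms = Π[ 1 ⋯ m ] (λ i → binom (x i) (j ⟨ i ⟩))

-- Specialisation to a weak composition s

module _ (n : ℕ) (s : Vec ℕ n) where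

  reversed : ℕ → ℤ
  reversed i = + (s ⟨ n ∸ i ℕ.+ 1 ⟩)

  x₁ x₂ : ℕ → ℤ
  x₁ i = reversed i + + 1
  x₂ i = reflectedUpper i (reversed i)

  partialSum-x₁ : ∀ t → t < n →
    partialSum x₁ (suc t) - + t ≡ + 1 + Σ[ n ∸ suc t ℕ.+ 1 ⋯ n ] (λ r → + (s ⟨ r ⟩))
  partialSum-x₁ t t<n = begin
    partialSum x₁ (suc t) - + t
      ≡⟨ cong (_- + t) (sum-map-+ (upTo (suc t)) (reversed ∘ suc) (λ _ → + 1)) ⟩
    ∑< (suc t) (reversed ∘ suc) + ∑< (suc t) (λ _ → + 1) - + t
      ≡⟨ cong (λ c → ∑< (suc t) (reversed ∘ suc) + c - + t) (∑<-const (suc t) (+ 1)) ⟩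
    ∑< (suc t) (reversed ∘ suc) + + suc t * + 1 - + t
      ≡⟨ cancel (∑< (suc t) (reversed ∘ suc)) (+ t) ⟩
    + 1 + ∑< (suc t) (reversed ∘ suc)
      ≡⟨ cong (_+_ (+ 1)) (∑<-cong (suc t) (λ u u≤t →
           cong (λ r → + (s ⟨ r ⟩)) (∸-suc-+1 (ℕP.≤-<-trans (ℕP.≤-pred u≤t) t<n)))) ⟩
    + 1 + ∑< (suc t) (λ u → + (s ⟨ n ∸ u ⟩))
      ≡⟨ cong (_+_ (+ 1)) (Σ[⋯]-top n (suc t) (λ r → + (s ⟨ r ⟩)) t<n) ⟨
    + 1 + Σ[ n ∸ suc t ℕ.+ 1 ⋯ n ] (λ r → + (s ⟨ r ⟩)) ∎
    where
    cancel : ∀ S t → S + (+ 1 + t) * + 1 - t ≡ + 1 + S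
    cancel = solve-∀

  partialSum-x₂ : ∀ t → partialSum x₂ (suc t) - + t ≡ - (partialSum x₁ (suc t) - + t)
  partialSum-x₂ zero    = base (reversed 1)
    where
    base : ∀ r → - (r + + 1) + + 0 - + 0 ≡ - (r + + 1 + + 0 - + 0)
    base = solve-∀
  partialSum-x₂ (suc t) = begin
    partialSum x₂ (suc (suc t)) - + suc t
      ≡⟨ cong (_- + suc t) (∑<-suc (suc t) (x₂ ∘ suc)) ⟩
    partialSum x₂ (suc t) + (+ 1 - r) - (+ 1 + + t)
      ≡⟨ stepˡ (partialSum x₂ (suc t)) r (+ t) ⟩
    partialSum x₂ (suc t) - + t - r
      ≡⟨ cong (_- r) (partialSum-x₂ t) ⟩
    - (partialSum x₁ (suc t) - + t) - r
      ≡⟨ stepʳ (partialSum x₁ (suc t)) r (+ t) ⟩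
    - (partialSum x₁ (suc t) + (r + + 1) - (+ 1 + + t))
      ≡⟨ cong (λ S → - (S - + suc t)) (∑<-suc (suc t) (x₁ ∘ suc)) ⟨
    - (partialSum x₁ (suc (suc t)) - + suc t) ∎
    where
    r = reversed (suc (suc t))
    stepˡ : ∀ S r t → S + (+ 1 - r) - (+ 1 + t) ≡ S - t - r
    stepˡ = solve-∀
    stepʳ : ∀ S r t → - (S - t) - r ≡ - (S + (r + + 1) - (+ 1 + t))
    stepʳ = solve-∀

  partialProduct-x₂ : ∀ m → partialProduct x₂ m ≡ -1ℤ ^ m * partialProduct x₁ m
  partialProduct-x₂ m =
    trans (∏<-cong m (λ t _ → partialSum-x₂ t)) (∏<-neg m (λ t → partialSum x₁ (suc t) - + t))

  factor₂-term : ∀ m (j : Vec ℕ m) → sumℕ (toList j) ≡ m →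
    Π[ 1 ⋯ m ] (λ i → factor₂ i (s ⟨ n ∸ i ℕ.+ 1 ⟩) (j ⟨ i ⟩)) * weight m j ≡ -1ℤ ^ m * binomTerm x₂ m j
  factor₂-term m j Σj≡m = begin
    Π[ 1 ⋯ m ] (λ i → factor₂ i (s ⟨ n ∸ i ℕ.+ 1 ⟩) (j ⟨ i ⟩)) * weight m j
      ≡⟨ cong (_* weight m j) (cong prodℤ (LP.map-cong (λ i → factor₂-reflect i _ (j ⟨ i ⟩)) (range 1 m))) ⟩
    Π[ 1 ⋯ m ] (λ i → -1ℤ ^ (j ⟨ i ⟩) * binom (x₂ i) (j ⟨ i ⟩)) * weight m j
      ≡⟨ cong (_* weight m j) (prod-map-* (range 1 m) (λ i → -1ℤ ^ (j ⟨ i ⟩)) (λ i → binom (x₂ i) (j ⟨ i ⟩))) ⟩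
    Π[ 1 ⋯ m ] (λ i → -1ℤ ^ (j ⟨ i ⟩)) * Binoms * weight m j
      ≡⟨ cong (λ c → c * Binoms * weight m j) (trans (Π[1⋯]-^ -1ℤ j) (cong (-1ℤ ^_) Σj≡m)) ⟩
    -1ℤ ^ m * Binoms * weight m j
      ≡⟨ ℤP.*-assoc (-1ℤ ^ m) Binoms (weight m j) ⟩
    -1ℤ ^ m * binomTerm x₂ m j ∎
    where
    Binoms = Π[ 1 ⋯ m ] (λ i → binom (x₂ i) (j ⟨ i ⟩))

  topSums≡Σcomp-x₁ : ∀ m → m ≤ n →
    Π[ 1 ⋯ m ] (λ i → + 1 + Σ[ n ∸ i ℕ.+ 1 ⋯ n ] (λ r → + (s ⟨ r ⟩))) ≡ Σcomp m (binomTerm x₁ m)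
  topSums≡Σcomp-x₁ m m≤n = begin
    Π[ 1 ⋯ m ] (λ i → + 1 + Σ[ n ∸ i ℕ.+ 1 ⋯ n ] (λ r → + (s ⟨ r ⟩)))
      ≡⟨ Π[1⋯]≡∏< m (λ i → + 1 + Σ[ n ∸ i ℕ.+ 1 ⋯ n ] (λ r → + (s ⟨ r ⟩))) ⟩
    ∏< m (λ t → + 1 + Σ[ n ∸ suc t ℕ.+ 1 ⋯ n ] (λ r → + (s ⟨ r ⟩)))
      ≡⟨ ∏<-cong m (λ t t<m → sym (partialSum-x₁ t (ℕP.<-≤-trans t<m m≤n))) ⟩
    partialProduct x₁ m
      ≡⟨ Σcomp-binomTerm x₁ m ⟨
    Σcomp m (binomTerm x₁ m) ∎

  Σcomp-x₁≡Σcomp-factor₂ : ∀ m →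
    Σcomp m (binomTerm x₁ m) ≡
    Σcomp m (λ j → Π[ 1 ⋯ m ] (λ i → factor₂ i (s ⟨ n ∸ i ℕ.+ 1 ⟩) (j ⟨ i ⟩)) * weight m j)
  Σcomp-x₁≡Σcomp-factor₂ m = begin
    Σcomp m (binomTerm x₁ m)
      ≡⟨ Σcomp-binomTerm x₁ m ⟩
    partialProduct x₁ m
      ≡⟨ -1^-flip m (partialProduct-x₂ m) ⟩
    -1ℤ ^ m * partialProduct x₂ m
      ≡⟨ cong (-1ℤ ^ m *_) (Σcomp-binomTerm x₂ m) ⟨
    -1ℤ ^ m * Σcomp m (binomTerm x₂ m)
      ≡⟨ sum-map-*ˡ (-1ℤ ^ m) (filter (validComp? m) (box m m)) (binomTerm x₂ m) ⟨
    Σcomp m (λ j → -1ℤ ^ m * binomTerm x₂ m j)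
      ≡⟨ cong sumℤ (LP.map-cong-local (All.map (λ {j} (Σj≡m , _) → sym (factor₂-term m j Σj≡m))
                                              (AllP.all-filter (validComp? m) (box m m)))) ⟩
    Σcomp m (λ j → Π[ 1 ⋯ m ] (λ i → factor₂ i (s ⟨ n ∸ i ℕ.+ 1 ⟩) (j ⟨ i ⟩)) * weight m j) ∎

corollary6p2 : (n : ℕ) → 1 ≤ n → (s : Vec ℕ n) →
    (Π[ 1 ⋯ n ∸ 1 ] (λ i → + 1 + Σ[ n ∸ i ℕ.+ 1 ⋯ n ] (λ r → + (s ⟨ r ⟩)))
      ≡ Σcomp (n ∸ 1) (λ j →
          Π[ 1 ⋯ n ∸ 1 ] (λ i → binom (+ (s ⟨ n ∸ i ℕ.+ 1 ⟩) + + 1) (j ⟨ i ⟩))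
            * weight (n ∸ 1) j))
    × (Σcomp (n ∸ 1) (λ j →
          Π[ 1 ⋯ n ∸ 1 ] (λ i → binom (+ (s ⟨ n ∸ i ℕ.+ 1 ⟩) + + 1) (j ⟨ i ⟩))
            * weight (n ∸ 1) j)
      ≡ Σcomp (n ∸ 1) (λ j →
          Π[ 1 ⋯ n ∸ 1 ] (λ i → factor₂ i (s ⟨ n ∸ i ℕ.+ 1 ⟩) (j ⟨ i ⟩))
            * weight (n ∸ 1) j))
corollary6p2 n _ s = topSums≡Σcomp-x₁ n s (n ∸ 1) (ℕP.m∸n≤m n 1) , Σcomp-x₁≡Σcomp-factor₂ n s (n ∸ 1)
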